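{- Let $p,q\ge 3$ be relatively prime integers, and let $r,s\ge 3$ be integers each relatively prime to $pq$. If $r\equiv s\pmod{pq}$ and $n\equiv n'\pmod{pq}$ are integers, then $f_r(n)=f_s(n')$.
   Context: For relatively prime $p,q$ and an integer $r\ge 3$ relatively prime to $pq$, every integer $n$ has a unique representation $n=x_nqr+y_nrp+z_npq+\delta_npqr$ with $0\le x_n<p$, $0\le y_n<q$, $0\le z_n<r$, $\delta_n\in\mathbb Z$; define $f_r(n)=x_nq+y_np$. (Equivalently, with $r^*$ the inverse of $r$ modulo $pq$ and $[N]_{pq}$ the least nonnegative residue of $N$ modulo $pq$, $f_r(n)=[nr^*]_{pq}$ if $[nr^*]_{pq}$ is of the form $xq+yp$ with integers $x,y\ge 0$, and $f_r(n)=[nr^*]_{pq}+pq$ otherwise.) -}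

module Defs where

open import Data.Nat as ℕ using (ℕ)
open import Data.Integer as ℤ using (ℤ; +_)
open import Relation.Binary.PropositionalEquality using (_≡_)

record Rep (p q r : ℕ) (n : ℤ) : Set where
  constructor rep
  field
    x : ℕ
    y : ℕ
    z : ℕ
    δ : ℤ
    x<p : x ℕ.< p
    y<q : y ℕ.< q
    z<r : z ℕ.< r
    eqn : n ≡ (+ x) ℤ.* (+ q) ℤ.* (+ r) ℤ.+ (+ y) ℤ.* (+ r) ℤ.* (+ p)
              ℤ.+ (+ z) ℤ.* (+ p) ℤ.* (+ q) ℤ.+ δ ℤ.* (+ p) ℤ.* (+ q) ℤ.* (+ r)

-- f_r(n) = x_n q + y_n p, read off from the (unique) representation.
fval : ∀ {p q r n} → Rep p q r n → ℕ
fval {p} {q} R = Rep.x R ℕ.* q ℕ.+ Rep.y R ℕ.* p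

module Submission where

-- Write  n = x q r + y r p + z p q + δ p q r.  Reducing modulo p
-- kills every term but the first, so  n ≡ x q r (mod p), and likewise
-- n' ≡ x' q s (mod p) for the representation of n' with respect to s.
-- As p divides both n - n' and r - s, it divides
--   (x - x') q s = (n - n') - (n - x q r) + (n' - x' q s) - x q (r - s),
-- and since p is coprime to q and to s it divides x - x'; both lie in
-- [0, p), hence x = x'.  Swapping the roles of p and q (which turns a
-- representation into one with x and y exchanged) gives y = y' by the same
-- argument, so  f_r(n) = x q + y p = x' q + y' p = f_s(n').

open import Defs
open import Data.Nat as ℕ using (ℕ)
open import Data.Nat.Coprimality using (Coprime)
open import Data.Integer as ℤ using (ℤ; +_)
open import Data.Integer.Divisibility as ℤd using ()
open import Relation.Binary.PropositionalEquality using (_≡_)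

open import Relation.Binary.PropositionalEquality
  using (refl; sym; trans; cong; cong₂; subst)
open import Data.Product using (_,_)
open import Data.Sum using (inj₁; inj₂)
open import Data.Integer using (_*_; _+_; _-_)
import Data.Nat.Properties as ℕP
import Data.Nat.Divisibility as ℕd
import Data.Nat.DivMod as ℕDM
import Data.Nat.Coprimality as ℕC
import Data.Integer.Properties as ℤP
import Data.Integer.Divisibility.Signed as ℤs
import Data.Integer.Coprimality as ℤC
open import Data.Integer.Tactic.RingSolver using (solve-∀)

coprime-*ˡ : ∀ {k m n} → Coprime k (m ℕ.* n) → Coprime k m
coprime-*ˡ {n = n} c (d∣k , d∣m) = c (d∣k , ℕd.∣-trans d∣m (ℕd.m∣m*n n))

coprime-*ʳ : ∀ {k m n} → Coprime k (m ℕ.* n) → Coprime k n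
coprime-*ʳ {m = m} c (d∣k , d∣n) = c (d∣k , ℕd.∣-trans d∣n (ℕd.n∣m*n m))

multiple-below : ∀ {m d} → m ℕd.∣ d → d ℕ.< m → d ≡ 0
multiple-below {ℕ.suc m} {d} m∣d d<m =
  trans (sym (ℕDM.m<n⇒m%n≡m d<m)) (ℕd.n∣m⇒m%n≡0 d (ℕ.suc m) m∣d)

ordered-residues-equal : ∀ {m a b} → a ℕ.≤ b → b ℕ.< m →
  m ℕd.∣ ℤ.∣ a ℤ.⊖ b ∣ → a ≡ b
ordered-residues-equal {m} {a} {b} a≤b b<m m∣a⊖b = ℕP.≤-antisym a≤b b≤a
  where
  b-a≡0 : b ℕ.∸ a ≡ 0
  b-a≡0 = multiple-below (subst (m ℕd.∣_) (ℤP.∣⊖∣-≤ a≤b) m∣a⊖b)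
                         (ℕP.≤-<-trans (ℕP.m∸n≤m b a) b<m)
  b≤a : b ℕ.≤ a
  b≤a = ℕP.m∸n≡0⇒m≤n b-a≡0

residues-equal : ∀ {m a b} → a ℕ.< m → b ℕ.< m → (+ m) ℤd.∣ (+ a - + b) → a ≡ b
residues-equal {m} {a} {b} a<m b<m m∣a-b with ℕP.≤-total a b
... | inj₁ a≤b = ordered-residues-equal a≤b b<m m∣a⊖b
  where
  m∣a⊖b : m ℕd.∣ ℤ.∣ a ℤ.⊖ b ∣
  m∣a⊖b = subst (λ t → m ℕd.∣ ℤ.∣ t ∣) (ℤP.[+m]-[+n]≡m⊖n a b) m∣a-b
... | inj₂ b≤a = sym (ordered-residues-equal b≤a a<m m∣b⊖a)
  where
  m∣b⊖a : m ℕd.∣ ℤ.∣ b ℤ.⊖ a ∣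
  m∣b⊖a = subst (m ℕd.∣_)
            (trans (cong ℤ.∣_∣ (ℤP.[+m]-[+n]≡m⊖n a b)) (ℤP.∣m⊖n∣≡∣n⊖m∣ a b)) m∣a-b

residue-mod-p : ∀ {p q r n} (R : Rep p q r n) →
  (+ p) ℤs.∣ (n - + Rep.x R * + q * + r)
residue-mod-p {p} {q} {r} (rep x y z δ _ _ _ refl) =
  ℤs.divides (+ y * + r + + z * + q + δ * + q * + r)
             (expand (+ x) (+ y) (+ z) δ (+ p) (+ q) (+ r))
  where
  expand : ∀ X Y Z D P Q R →
    (X * Q * R + Y * R * P + Z * P * Q + D * P * Q * R) - X * Q * R
      ≡ (Y * R + Z * Q + D * Q * R) * P
  expand = solve-∀

swap : ∀ {p q r n} → Rep p q r n → Rep q p r n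
swap {p} {q} {r} (rep x y z δ x<p y<q z<r eqn) =
  rep y x z δ y<q x<p z<r (trans eqn (reorder (+ x) (+ y) (+ z) δ (+ p) (+ q) (+ r)))
  where
  reorder : ∀ X Y Z D P Q R →
    X * Q * R + Y * R * P + Z * P * Q + D * P * Q * R
      ≡ Y * P * R + X * R * Q + Z * Q * P + D * Q * P * R
  reorder = solve-∀

x-determined : ∀ {p q r s n n'} → Coprime p q → Coprime p s →
  (+ p) ℤd.∣ (+ r - + s) → (+ p) ℤd.∣ (n - n') →
  (R : Rep p q r n) (S : Rep p q s n') → Rep.x R ≡ Rep.x S
x-determined {p} {q} {r} {s} {n} {n'} p⊥q p⊥s p∣r-s p∣n-n' R S =
  residues-equal (Rep.x<p R) (Rep.x<p S) p∣x-x'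
  where
  X X' : ℤ
  X  = + Rep.x R
  X' = + Rep.x S
  -- (x - x') q s as a combination of quantities divisible by p.
  combine : ∀ N N' X X' Q R S →
    Q * (S * (X - X'))
      ≡ ((N - N') - (N - X * Q * R) + (N' - X' * Q * S)) - X * Q * (R - S)
  combine = solve-∀
  p∣n-n'ˢ : (+ p) ℤs.∣ (n - n')
  p∣n-n'ˢ = ℤs.∣ᵤ⇒∣ p∣n-n'
  p∣xq[r-s] : (+ p) ℤs.∣ (X * + q * (+ r - + s))
  p∣xq[r-s] = ℤs.∣n⇒∣m*n (X * + q) (ℤs.∣ᵤ⇒∣ p∣r-s)
  p∣qs[x-x'] : (+ p) ℤs.∣ (+ q * (+ s * (X - X')))
  p∣qs[x-x'] = subst ((+ p) ℤs.∣_) (sym (combine n n' X X' (+ q) (+ r) (+ s)))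
    (ℤs.∣m∣n⇒∣m-n (ℤs.∣m∣n⇒∣m+n (ℤs.∣m∣n⇒∣m-n p∣n-n'ˢ (residue-mod-p R)) (residue-mod-p S))
                  p∣xq[r-s])
  p∣x-x' : (+ p) ℤd.∣ (X - X')
  p∣x-x' = ℤC.coprime-divisor (+ p) (+ s) (X - X') p⊥s
             (ℤC.coprime-divisor (+ p) (+ q) (+ s * (X - X')) p⊥q (ℤs.∣⇒∣ᵤ p∣qs[x-x']))

lemma5 : (p q r s : ℕ) → 3 ℕ.≤ p → 3 ℕ.≤ q → 3 ℕ.≤ r → 3 ℕ.≤ s →
    Coprime p q → Coprime r (p ℕ.* q) → Coprime s (p ℕ.* q) →
    (n n' : ℤ) →
    (+ (p ℕ.* q)) ℤd.∣ ((+ r) ℤ.- (+ s)) →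
    (+ (p ℕ.* q)) ℤd.∣ (n ℤ.- n') →
    (R : Rep p q r n) → (S : Rep p q s n') → fval R ≡ fval S
lemma5 p q r s _ _ _ _ p⊥q _ s⊥pq n n' pq∣r-s pq∣n-n' R S =
  cong₂ (λ a b → a ℕ.* q ℕ.+ b ℕ.* p) x≡x' y≡y'
  where
  p∣pq : p ℕd.∣ p ℕ.* q
  p∣pq = ℕd.m∣m*n q
  q∣pq : q ℕd.∣ p ℕ.* q
  q∣pq = ℕd.n∣m*n p
  x≡x' : Rep.x R ≡ Rep.x S
  x≡x' = x-determined p⊥q (ℕC.sym (coprime-*ˡ s⊥pq))
           (ℕd.∣-trans p∣pq pq∣r-s) (ℕd.∣-trans p∣pq pq∣n-n') R S
  y≡y' : Rep.y R ≡ Rep.y S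
  y≡y' = x-determined (ℕC.sym p⊥q) (ℕC.sym (coprime-*ʳ {m = p} s⊥pq))
           (ℕd.∣-trans q∣pq pq∣r-s) (ℕd.∣-trans q∣pq pq∣n-n') (swap R) (swap S)
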